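{- Let $r\geq 2$ and $n>r^{8}$. Every graph $G$ of order $n$ with $e(G)>t_{r}(n)$ has an induced subgraph $G'$ of order $n'>(1-1/r^{2})n$ such that either \[ K_{r+1}\subset G'\quad\text{and}\quad \delta(G')>\left(\frac{r-1}{r}-\frac{1}{r^{2}(r^{2}-1)}\right)n', \] or \[ e(G')>\left(\frac{r-1}{2r}+\frac{1}{r^{4}(r^{2}-1)}\right)(n')^{2}. \]
   Context: All graphs are finite and simple. $e(G)$ is the number of edges and $\delta(G)$ the minimum degree of $G$. $T_{r}(n)$ is the Turán graph: the complete $r$-partite graph on $n$ vertices whose part sizes differ by at most one; $t_{r}(n)=e(T_{r}(n))$. $K_{r+1}\subset G'$ means $G'$ contains a complete subgraph on $r+1$ vertices. -}

module Defs where

open import Data.Nat using (ℕ; zero; suc; _+_; _*_; _∸_; _^_; _≤_; _<_; _<ᵇ_; _≡ᵇ_; _⊓_; NonZero)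
open import Data.Nat.DivMod using (_%_)
open import Data.Bool using (Bool; true; false; if_then_else_; _∧_; not)
open import Data.Fin using (Fin; toℕ)
import Data.Fin as F
open import Data.Product using (Σ; _×_; _,_)
open import Function.Definitions using (Injective)
open import Relation.Binary.PropositionalEquality using (_≡_; refl)
open import Relation.Nullary using (¬_)

record Graph (n : ℕ) : Set where
  field
    adj    : Fin n → Fin n → Bool
    sym    : ∀ i j → adj i j ≡ adj j i
    irrefl : ∀ i → adj i i ≡ false
open Graph public

sumF : ∀ {n} → (Fin n → ℕ) → ℕ
sumF {zero}  f = 0
sumF {suc n} f = f F.zero + sumF (λ i → f (F.suc i))

countF : ∀ {n} → (Fin n → Bool) → ℕ
countF p = sumF (λ i → if p i then 1 else 0)

degree : ∀ {n} → Graph n → Fin n → ℕ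
degree G v = countF (adj G v)

edges : ∀ {n} → Graph n → ℕ
edges G = sumF (λ i → countF (λ j → (toℕ i <ᵇ toℕ j) ∧ adj G i j))

minF : ∀ {n} → ℕ → (Fin n → ℕ) → ℕ
minF {zero}  d f = d
minF {suc n} d f = f F.zero ⊓ minF d (λ i → f (F.suc i))

-- δ(G): minimum degree (for n ≥ 1 this is the true minimum, since every
-- degree is < n; for the empty graph it is 0)
minDegree : ∀ {n} → Graph n → ℕ
minDegree {n} G = minF n (degree G)

-- induced subgraph on the image of an injective map f : Fin m → Fin n
induced : ∀ {m n} → Graph n → (f : Fin m → Fin n) → Graph m
induced G f = record
  { adj    = λ i j → adj G (f i) (f j)
  ; sym    = λ i j → sym G (f i) (f j)
  ; irrefl = λ i → irrefl G (f i)
  }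

ContainsClique : ∀ {n} → ℕ → Graph n → Set
ContainsClique {n} k G =
  Σ (Fin k → Fin n) λ f → Injective _≡_ _≡_ f ×
    (∀ i j → ¬ (i ≡ j) → adj G (f i) (f j) ≡ true)

-- Turán graph T_r(n): vertex i lies in part (i mod r); adjacent iff parts differ.
-- Part sizes are ⌊n/r⌋ or ⌈n/r⌉, so they differ by at most one.
≡ᵇ-sym : ∀ a b → (a ≡ᵇ b) ≡ (b ≡ᵇ a)
≡ᵇ-sym zero zero = refl
≡ᵇ-sym zero (suc b) = refl
≡ᵇ-sym (suc a) zero = refl
≡ᵇ-sym (suc a) (suc b) = ≡ᵇ-sym a b

≡ᵇ-refl : ∀ a → (a ≡ᵇ a) ≡ true
≡ᵇ-refl zero = refl
≡ᵇ-refl (suc a) = ≡ᵇ-refl a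

turanGraph : (r : ℕ) .{{_ : NonZero r}} (n : ℕ) → Graph n
turanGraph r n = record
  { adj    = λ i j → not ((toℕ i % r) ≡ᵇ (toℕ j % r))
  ; sym    = λ i j → cong′ (≡ᵇ-sym (toℕ i % r) (toℕ j % r))
  ; irrefl = λ i → cong′ (≡ᵇ-refl (toℕ i % r))
  }
  where
  cong′ : ∀ {a b} → a ≡ b → not a ≡ not b
  cong′ refl = refl

turanNumber : (r : ℕ) .{{_ : NonZero r}} (n : ℕ) → ℕ
turanNumber r n = edges (turanGraph r n)

-- Delete vertices of small degree one at a time, at most ⌊(n − 1)/r²⌋ of them. If at some moment
-- the current graph G' has δ(G') > ((r − 1)/r − 1/(r²(r² − 1))) n', stop: every deleted vertex had
-- degree at most t_r(m) − t_r(m − 1), so e(G') > t_r(n') still holds and Turán's theorem yields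
-- K_{r+1}. Otherwise each deletion raises e − (r − 1) m²/(2r) by about m/(r²(r² − 1)); after the
-- n/r² deletions the accumulated gain beats both m²/(r⁴(r² − 1)) and the initial deficit
-- (r − 1) n/(2r) left by e(G) > t_r(n), the latter only because n > r⁸.
-- Turán's theorem is proved the same way: delete a vertex of degree at most t_r(m) − t_r(m − 1),
-- or, if there is none, grow a clique greedily inside common neighbourhoods.

module Submission where

open import Defs
open import Data.Nat using (ℕ; zero; suc; _+_; _*_; _∸_; _^_; _≤_; _<_; NonZero; z≤n; s≤s; _<ᵇ_; _≡ᵇ_; _≤?_; _<?_; >-nonZero⁻¹)
open import Data.Nat.Properties
open import Data.Nat.DivMod using (_%_; _/_; m<n⇒m%n≡m; [m+n]%n≡m%n; m%n<n; m≡m%n+[m/n]*n)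
open import Data.Nat.Tactic.RingSolver using (solve-∀)
open import Data.Fin using (Fin; toℕ; fromℕ; punchIn) renaming (zero to fz; suc to fs)
open import Data.Fin.Properties using (punchIn-injective; toℕ-injective; toℕ-fromℕ) renaming (_≟_ to _≟ᶠ_)
open import Data.Bool using (Bool; true; false; if_then_else_; _∧_; not)
open import Data.Product using (Σ; _×_; _,_; proj₁; proj₂)
open import Data.Sum using (_⊎_; inj₁; inj₂)
open import Data.Empty using (⊥; ⊥-elim)
open import Function.Definitions using (Injective)
open import Relation.Nullary using (¬_; yes; no)
open import Relation.Binary.PropositionalEquality
  using (_≡_; refl; trans; cong; cong₂; subst; subst₂; module ≡-Reasoning)
  renaming (sym to ≡-sym)

[_] : Bool → ℕ
[ b ] = if b then 1 else 0

sumF-cong : ∀ {n} {f g : Fin n → ℕ} → (∀ i → f i ≡ g i) → sumF f ≡ sumF g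
sumF-cong {zero}  h = refl
sumF-cong {suc n} h = cong₂ _+_ (h fz) (sumF-cong (λ i → h (fs i)))

sumF-mono : ∀ {n} {f g : Fin n → ℕ} → (∀ i → f i ≤ g i) → sumF f ≤ sumF g
sumF-mono {zero}  h = z≤n
sumF-mono {suc n} h = +-mono-≤ (h fz) (sumF-mono (λ i → h (fs i)))

sumF-+ : ∀ {n} (f g : Fin n → ℕ) → sumF (λ i → f i + g i) ≡ sumF f + sumF g
sumF-+ {zero}  f g = refl
sumF-+ {suc n} f g =
  trans (cong (f fz + g fz +_) (sumF-+ (λ i → f (fs i)) (λ i → g (fs i))))
        (+-+-interchange (f fz) (g fz) _ _)
  where
  +-+-interchange : ∀ a b c d → (a + b) + (c + d) ≡ (a + c) + (b + d)
  +-+-interchange = solve-∀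

sumF-zero : ∀ n → sumF {n} (λ _ → 0) ≡ 0
sumF-zero zero    = refl
sumF-zero (suc n) = sumF-zero n

sumF-one : ∀ n → sumF {n} (λ _ → 1) ≡ n
sumF-one zero    = refl
sumF-one (suc n) = cong suc (sumF-one n)

sumF-swap : ∀ {a b} (h : Fin a → Fin b → ℕ) →
  sumF (λ i → sumF (h i)) ≡ sumF (λ j → sumF (λ i → h i j))
sumF-swap {zero}  {b} h = ≡-sym (sumF-zero b)
sumF-swap {suc a}     h =
  trans (cong (sumF (h fz) +_) (sumF-swap (λ i → h (fs i))))
        (≡-sym (sumF-+ (h fz) (λ j → sumF (λ i → h (fs i) j))))

sumF-punchIn : ∀ {n} (f : Fin (suc n) → ℕ) (v : Fin (suc n)) →
  sumF f ≡ f v + sumF (λ i → f (punchIn v i))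
sumF-punchIn         f fz     = refl
sumF-punchIn {suc n} f (fs v) =
  trans (cong (f fz +_) (sumF-punchIn (λ i → f (fs i)) v)) (+-left-comm (f fz) (f (fs v)) _)
  where
  +-left-comm : ∀ a b c → a + (b + c) ≡ b + (a + c)
  +-left-comm = solve-∀

countF-≤ : ∀ {n} (p : Fin n → Bool) → countF p ≤ n
countF-≤ {n} p = ≤-trans (sumF-mono (λ i → [b]≤1 (p i))) (≤-reflexive (sumF-one n))
  where
  [b]≤1 : ∀ b → [ b ] ≤ 1
  [b]≤1 true  = ≤-refl
  [b]≤1 false = z≤n

countF-witness : ∀ {n} (p : Fin n → Bool) → 1 ≤ countF p → Σ (Fin n) λ i → p i ≡ true
countF-witness {suc n} p h with p fz in eq
... | true  = fz , eq
... | false with countF-witness (λ i → p (fs i)) h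
...   | i , pi = fs i , pi

countF+countF-not : ∀ {n} (p : Fin n → Bool) → countF p + countF (λ i → not (p i)) ≡ n
countF+countF-not {n} p =
  trans (≡-sym (sumF-+ (λ i → [ p i ]) (λ i → [ not (p i) ])))
        (trans (sumF-cong (λ i → [b]+[not-b] (p i))) (sumF-one n))
  where
  [b]+[not-b] : ∀ b → [ b ] + [ not b ] ≡ 1
  [b]+[not-b] true  = refl
  [b]+[not-b] false = refl

countF-≤-∧+not : ∀ {n} (p q : Fin n → Bool) →
  countF p ≤ countF (λ i → p i ∧ q i) + countF (λ i → not (q i))
countF-≤-∧+not p q =
  ≤-trans (sumF-mono (λ i → pointwise (p i) (q i)))
          (≤-reflexive (sumF-+ (λ i → [ p i ∧ q i ]) (λ i → [ not (q i) ])))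
  where
  pointwise : ∀ a b → [ a ] ≤ [ a ∧ b ] + [ not b ]
  pointwise true  true  = s≤s z≤n
  pointwise true  false = s≤s z≤n
  pointwise false b     = z≤n

<ᵇ-asym : ∀ a b → (a <ᵇ b) ≡ true → (b <ᵇ a) ≡ true → ⊥
<ᵇ-asym zero    zero    () _
<ᵇ-asym zero    (suc b) _  ()
<ᵇ-asym (suc a) zero    () _
<ᵇ-asym (suc a) (suc b) h₁ h₂ = <ᵇ-asym a b h₁ h₂

<ᵇ-connex : ∀ a b → (a <ᵇ b) ≡ false → (b <ᵇ a) ≡ false → a ≡ b
<ᵇ-connex zero    zero    _  _  = refl
<ᵇ-connex zero    (suc b) () _
<ᵇ-connex (suc a) zero    _  ()
<ᵇ-connex (suc a) (suc b) h₁ h₂ = cong suc (<ᵇ-connex a b h₁ h₂)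

handshake : ∀ {n} (G : Graph n) → sumF (degree G) ≡ edges G + edges G
handshake G = begin
  sumF (λ i → sumF (λ j → [ adj G i j ]))
    ≡⟨ sumF-cong (λ i → trans (sumF-cong (split i)) (sumF-+ (forward i) (λ j → backward j i))) ⟩
  sumF (λ i → sumF (forward i) + sumF (λ j → backward j i))
    ≡⟨ sumF-+ (λ i → sumF (forward i)) (λ i → sumF (λ j → backward j i)) ⟩
  edges G + sumF (λ i → sumF (λ j → backward j i))
    ≡⟨ cong (edges G +_) (sumF-swap (λ i j → backward j i)) ⟩
  edges G + edges G ∎
  where
  open ≡-Reasoning
  forward backward : _ → _ → ℕ
  forward  i j = [ (toℕ i <ᵇ toℕ j) ∧ adj G i j ]
  backward j i = [ (toℕ j <ᵇ toℕ i) ∧ adj G j i ]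
  split-bool : ∀ x y a → (x ≡ true → y ≡ true → ⊥) → (x ≡ false → y ≡ false → a ≡ false) →
    [ a ] ≡ [ x ∧ a ] + [ y ∧ a ]
  split-bool true  true  a h₁ h₂ = ⊥-elim (h₁ refl refl)
  split-bool true  false a h₁ h₂ = ≡-sym (+-identityʳ _)
  split-bool false true  a h₁ h₂ = refl
  split-bool false false a h₁ h₂ rewrite h₂ refl refl = refl
  split : ∀ i j → [ adj G i j ] ≡ forward i j + backward j i
  split i j rewrite sym G j i = split-bool _ _ _ (<ᵇ-asym (toℕ i) (toℕ j))
    (λ h₁ h₂ → subst (λ k → adj G i k ≡ false) (toℕ-injective (<ᵇ-connex (toℕ i) (toℕ j) h₁ h₂)) (irrefl G i))

edges-cong : ∀ {n} (G H : Graph n) → (∀ i j → adj G i j ≡ adj H i j) → edges G ≡ edges H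
edges-cong G H h = sumF-cong (λ i → sumF-cong (λ j → cong (λ b → [ (toℕ i <ᵇ toℕ j) ∧ b ]) (h i j)))

degreeSum-delete : ∀ {n} (G : Graph (suc n)) (v : Fin (suc n)) →
  sumF (degree G) ≡ degree G v + degree G v + sumF (degree (induced G (punchIn v)))
degreeSum-delete G v = begin
  sumF (degree G)
    ≡⟨ sumF-punchIn (degree G) v ⟩
  degree G v + sumF (λ i → degree G (punchIn v i))
    ≡⟨ cong (degree G v +_) (trans (sumF-cong row) (sumF-+ column (degree G-v))) ⟩
  degree G v + (sumF column + sumF (degree G-v))
    ≡⟨ cong (λ z → degree G v + (z + sumF (degree G-v))) column-sum ⟩
  degree G v + (degree G v + sumF (degree G-v))
    ≡⟨ ≡-sym (+-assoc (degree G v) (degree G v) _) ⟩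
  degree G v + degree G v + sumF (degree G-v) ∎
  where
  open ≡-Reasoning
  G-v = induced G (punchIn v)
  column : Fin _ → ℕ
  column i = [ adj G (punchIn v i) v ]
  row : ∀ i → degree G (punchIn v i) ≡ column i + degree G-v i
  row i = sumF-punchIn (λ j → [ adj G (punchIn v i) j ]) v
  column-sum : sumF column ≡ degree G v
  column-sum = trans (sumF-cong (λ i → cong [_] (sym G (punchIn v i) v)))
    (≡-sym (trans (sumF-punchIn (λ j → [ adj G v j ]) v)
                  (cong (λ b → [ b ] + sumF (λ i → [ adj G v (punchIn v i) ])) (irrefl G v))))

edges-delete : ∀ {n} (G : Graph (suc n)) (v : Fin (suc n)) →
  edges G ≡ edges (induced G (punchIn v)) + degree G v
edges-delete G v = *-cancelˡ-≡ (edges G) (edges G-v + degree G v) 2 (begin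
  2 * edges G                                       ≡⟨ cong (edges G +_) (+-identityʳ (edges G)) ⟩
  edges G + edges G                                 ≡⟨ ≡-sym (handshake G) ⟩
  sumF (degree G)                                   ≡⟨ degreeSum-delete G v ⟩
  degree G v + degree G v + sumF (degree G-v)       ≡⟨ cong (degree G v + degree G v +_) (handshake G-v) ⟩
  degree G v + degree G v + (edges G-v + edges G-v) ≡⟨ regroup (degree G v) (edges G-v) ⟩
  2 * (edges G-v + degree G v)                      ∎)
  where
  open ≡-Reasoning
  G-v = induced G (punchIn v)
  regroup : ∀ d e → d + d + (e + e) ≡ 2 * (e + d)
  regroup = solve-∀

induced-clique : ∀ {k m n} (G : Graph n) (g : Fin m → Fin n) → Injective _≡_ _≡_ g →
  ContainsClique k (induced G g) → ContainsClique k G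
induced-clique G g g-inj (h , h-inj , h-adj) = (λ i → g (h i)) , (λ e → h-inj (g-inj e)) , h-adj

minF-glb : ∀ {k} (d : ℕ) (f : Fin k → ℕ) x → x ≤ d → (∀ i → x ≤ f i) → x ≤ minF d f
minF-glb {zero}  d f x x≤d x≤f = x≤d
minF-glb {suc k} d f x x≤d x≤f = ⊓-glb (x≤f fz) (minF-glb d (λ i → f (fs i)) x x≤d (λ i → x≤f (fs i)))

argmin : ∀ {m} (f : Fin (suc m) → ℕ) → Σ (Fin (suc m)) λ v → ∀ i → f v ≤ f i
argmin {zero}  f = fz , λ { fz → ≤-refl }
argmin {suc m} f with argmin (λ i → f (fs i))
... | v , v-min with f fz ≤? f (fs v)
...   | yes le = fz   , λ { fz → ≤-refl ; (fs i) → ≤-trans le (v-min i) }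
...   | no  gt = fs v , λ { fz → <⇒≤ (≰⇒> gt) ; (fs i) → v-min i }

minDegree-vertex : ∀ {m} (G : Graph (suc m)) →
  Σ (Fin (suc m)) λ v → degree G v ≤ minDegree G × (∀ w → degree G v ≤ degree G w)
minDegree-vertex {m} G with argmin (degree G)
... | v , v-min = v , minF-glb (suc m) (degree G) (degree G v) (countF-≤ (adj G v)) v-min , v-min

sumBelow : (ℕ → ℕ) → ℕ → ℕ
sumBelow g zero    = 0
sumBelow g (suc x) = g 0 + sumBelow (λ j → g (suc j)) x

sumF-toℕ : ∀ {x} (g : ℕ → ℕ) → sumF {x} (λ i → g (toℕ i)) ≡ sumBelow g x
sumF-toℕ {zero}  g = refl
sumF-toℕ {suc x} g = cong (g 0 +_) (sumF-toℕ {x} (λ j → g (suc j)))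

sumBelow-+ : ∀ g a b → sumBelow g (a + b) ≡ sumBelow g a + sumBelow (λ j → g (a + j)) b
sumBelow-+ g zero    b = refl
sumBelow-+ g (suc a) b =
  trans (cong (g 0 +_) (sumBelow-+ (λ j → g (suc j)) a b)) (≡-sym (+-assoc (g 0) _ _))

sumBelow-cong : ∀ {g h : ℕ → ℕ} x → (∀ j → j < x → g j ≡ h j) → sumBelow g x ≡ sumBelow h x
sumBelow-cong zero    _ = refl
sumBelow-cong (suc x) e = cong₂ _+_ (e 0 (s≤s z≤n)) (sumBelow-cong x (λ j j<x → e (suc j) (s≤s j<x)))

sumBelow-zero : ∀ x → sumBelow (λ _ → 0) x ≡ 0
sumBelow-zero zero    = refl
sumBelow-zero (suc x) = sumBelow-zero x

sumBelow-[≡ᵇ] : ∀ c x → c < x → sumBelow (λ j → [ j ≡ᵇ c ]) x ≡ 1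
sumBelow-[≡ᵇ] zero    (suc x) _         = cong suc (sumBelow-zero x)
sumBelow-[≡ᵇ] (suc c) (suc x) (s≤s c<x) = sumBelow-[≡ᵇ] c x c<x

<⇒≡ᵇ-false : ∀ j x → j < x → (j ≡ᵇ x) ≡ false
<⇒≡ᵇ-false zero    (suc x) _         = refl
<⇒≡ᵇ-false (suc j) (suc x) (s≤s j<x) = <⇒≡ᵇ-false j x j<x

toℕ-punchIn-fromℕ : ∀ {x} (i : Fin x) → toℕ (punchIn (fromℕ x) i) ≡ toℕ i
toℕ-punchIn-fromℕ {suc x} fz     = refl
toℕ-punchIn-fromℕ {suc x} (fs i) = cong suc (toℕ-punchIn-fromℕ i)

module Turan (r : ℕ) .{{_ : NonZero r}} where

  sameClassBelow : ℕ → ℕ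
  sameClassBelow x = sumBelow (λ j → [ j % r ≡ᵇ x % r ]) x

  lastDegree : ℕ → ℕ
  lastDegree x = degree (turanGraph r (suc x)) (fromℕ x)

  sameClassBelow-< : ∀ x → x < r → sameClassBelow x ≡ 0
  sameClassBelow-< x x<r = trans
    (sumBelow-cong x (λ j j<x → cong [_] (trans (cong₂ _≡ᵇ_ (m<n⇒m%n≡m (<-trans j<x x<r)) (m<n⇒m%n≡m x<r))
                                                 (<⇒≡ᵇ-false j x j<x))))
    (sumBelow-zero x)

  [r+j]%r≡j%r : ∀ j → (r + j) % r ≡ j % r
  [r+j]%r≡j%r j = trans (cong (_% r) (+-comm r j)) ([m+n]%n≡m%n j r)

  sameClassBelow-+r : ∀ y → sameClassBelow (r + y) ≡ suc (sameClassBelow y)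
  sameClassBelow-+r y rewrite [r+j]%r≡j%r y = trans (sumBelow-+ g r y)
    (cong₂ _+_ (trans (sumBelow-cong r (λ j j<r → cong (λ z → [ z ≡ᵇ y % r ]) (m<n⇒m%n≡m j<r)))
                      (sumBelow-[≡ᵇ] (y % r) r (m%n<n y r)))
               (sumBelow-cong y (λ j _ → cong (λ z → [ z ≡ᵇ y % r ]) (r+j%r j))))
    where
    g : ℕ → ℕ
    g j = [ j % r ≡ᵇ y % r ]
    r+j%r : ∀ j → (r + j) % r ≡ j % r
    r+j%r j = trans (cong (_% r) (+-comm r j)) ([m+n]%n≡m%n j r)

  r*sameClassBelow≤ : ∀ x → r * sameClassBelow x ≤ x
  r*sameClassBelow≤ x = bounded-by x x ≤-refl
    where
    bounded-by : ∀ fuel x → x ≤ fuel → r * sameClassBelow x ≤ x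
    bounded-by zero     zero _ = ≤-reflexive (*-zeroʳ r)
    bounded-by (suc fuel) x x≤fuel with x <? r
    ... | yes x<r rewrite sameClassBelow-< x x<r | *-zeroʳ r = z≤n
    ... | no  x≮r = subst (λ z → r * sameClassBelow z ≤ z) r+y≡x step
      where
      y = x ∸ r
      r+y≡x : r + y ≡ x
      r+y≡x = m+[n∸m]≡n (≮⇒≥ x≮r)
      y≤fuel : y ≤ fuel
      y≤fuel = ≤-pred (≤-trans (≤-trans (+-monoˡ-≤ y (>-nonZero⁻¹ r)) (≤-reflexive r+y≡x)) x≤fuel)
      step : r * sameClassBelow (r + y) ≤ r + y
      step rewrite sameClassBelow-+r y | *-suc r (sameClassBelow y) = +-monoʳ-≤ r (bounded-by fuel y y≤fuel)

  lastDegree+sameClassBelow : ∀ x → lastDegree x + sameClassBelow x ≡ x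
  lastDegree+sameClassBelow x = suc-injective (begin
    suc (lastDegree x + sameClassBelow x) ≡⟨ cong suc (+-comm (lastDegree x) (sameClassBelow x)) ⟩
    suc (sameClassBelow x) + lastDegree x ≡⟨ cong (_+ lastDegree x) (≡-sym countF-same) ⟩
    countF same + lastDegree x            ≡⟨ countF+countF-not same ⟩
    suc x                                 ∎)
    where
    open ≡-Reasoning
    same : Fin (suc x) → Bool
    same j = (toℕ (fromℕ x) % r) ≡ᵇ (toℕ j % r)
    g : ℕ → ℕ
    g j = [ x % r ≡ᵇ j % r ]
    countF-same : countF same ≡ suc (sameClassBelow x)
    countF-same = begin
      countF same                       ≡⟨ sumF-cong {suc x} (λ j → cong (λ z → [ z % r ≡ᵇ toℕ j % r ]) (toℕ-fromℕ x)) ⟩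
      sumF {suc x} (λ j → g (toℕ j))    ≡⟨ sumF-toℕ {suc x} g ⟩
      sumBelow g (suc x)                ≡⟨ cong (sumBelow g) (+-comm 1 x) ⟩
      sumBelow g (x + 1)                ≡⟨ sumBelow-+ g x 1 ⟩
      sumBelow g x + (g (x + 0) + 0)    ≡⟨ cong₂ _+_ (sumBelow-cong x (λ j _ → cong [_] (≡ᵇ-sym (x % r) (j % r))))
                                                      (cong (λ z → [ x % r ≡ᵇ z % r ] + 0) (+-identityʳ x)) ⟩
      sameClassBelow x + ([ x % r ≡ᵇ x % r ] + 0) ≡⟨ cong (λ b → sameClassBelow x + ([ b ] + 0)) (≡ᵇ-refl (x % r)) ⟩
      sameClassBelow x + 1              ≡⟨ +-comm (sameClassBelow x) 1 ⟩
      suc (sameClassBelow x)            ∎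

  turanNumber-suc : ∀ x → turanNumber r (suc x) ≡ turanNumber r x + lastDegree x
  turanNumber-suc x = trans (edges-delete (turanGraph r (suc x)) (fromℕ x))
    (cong (_+ lastDegree x) (edges-cong (induced (turanGraph r (suc x)) (punchIn (fromℕ x))) (turanGraph r x)
      (λ i j → cong₂ (λ a b → not ((a % r) ≡ᵇ (b % r))) (toℕ-punchIn-fromℕ {x} i) (toℕ-punchIn-fromℕ {x} j))))

  -- Each new clique vertex has at most sameClassBelow x non-neighbours, so the common
  -- neighbourhood of k clique vertices keeps at least x + 1 − k · sameClassBelow x vertices,
  -- which stays positive up to k = r.
  module HighMinDegree (x : ℕ) (G : Graph (suc x)) (high : ∀ w → lastDegree x < degree G w) where

    nonNeighbours≤ : ∀ w → countF (λ u → not (adj G w u)) ≤ sameClassBelow x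
    nonNeighbours≤ w = +-cancelʳ-≤ (suc (lastDegree x)) _ _ (begin
      non + suc (lastDegree x)               ≤⟨ +-monoʳ-≤ non (high w) ⟩
      non + degree G w                       ≡⟨ +-comm non (degree G w) ⟩
      degree G w + non                       ≡⟨ countF+countF-not (adj G w) ⟩
      suc x                                  ≡⟨ cong suc (≡-sym (lastDegree+sameClassBelow x)) ⟩
      suc (lastDegree x + sameClassBelow x)  ≡⟨ cong suc (+-comm (lastDegree x) (sameClassBelow x)) ⟩
      suc (sameClassBelow x + lastDegree x)  ≡⟨ ≡-sym (+-suc (sameClassBelow x) (lastDegree x)) ⟩
      sameClassBelow x + suc (lastDegree x)  ∎)
      where
      open ≤-Reasoning
      non = countF (λ u → not (adj G w u))

    record PartialClique (k : ℕ) : Set where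
      field
        vertex      : Fin k → Fin (suc x)
        candidate   : Fin (suc x) → Bool
        adjacent    : ∀ i j → ¬ i ≡ j → adj G (vertex i) (vertex j) ≡ true
        candidate⇒adjacent : ∀ u → candidate u ≡ true → ∀ i → adj G (vertex i) u ≡ true
        many-candidates : suc x ≤ countF candidate + k * sameClassBelow x

    empty : PartialClique 0
    empty = record
      { vertex = λ () ; candidate = λ _ → true ; adjacent = λ () ; candidate⇒adjacent = λ _ _ ()
      ; many-candidates = ≤-reflexive (≡-sym (trans (+-identityʳ _) (sumF-one (suc x)))) }

    extend : ∀ k → k ≤ r → PartialClique k → PartialClique (suc k)
    extend k k≤r K = record
      { vertex = vertex′ ; candidate = candidate′ ; adjacent = adjacent′
      ; candidate⇒adjacent = candidate⇒adjacent′ ; many-candidates = many-candidates′ }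
      where
      open PartialClique K
      some-candidate : 1 ≤ countF candidate
      some-candidate = +-cancelʳ-≤ x 1 (countF candidate) (≤-trans many-candidates (+-monoʳ-≤ (countF candidate)
        (≤-trans (*-monoˡ-≤ (sameClassBelow x) k≤r) (r*sameClassBelow≤ x))))
      w = proj₁ (countF-witness candidate some-candidate)
      w-candidate = proj₂ (countF-witness candidate some-candidate)
      vertex′ : Fin (suc k) → Fin (suc x)
      vertex′ fz     = w
      vertex′ (fs i) = vertex i
      candidate′ : Fin (suc x) → Bool
      candidate′ u = candidate u ∧ adj G w u
      adjacent′ : ∀ i j → ¬ i ≡ j → adj G (vertex′ i) (vertex′ j) ≡ true
      adjacent′ fz     fz     i≢j = ⊥-elim (i≢j refl)
      adjacent′ fz     (fs j) _   = trans (sym G w (vertex j)) (candidate⇒adjacent w w-candidate j)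
      adjacent′ (fs i) fz     _   = candidate⇒adjacent w w-candidate i
      adjacent′ (fs i) (fs j) i≢j = adjacent i j (λ e → i≢j (cong fs e))
      candidate⇒adjacent′ : ∀ u → candidate′ u ≡ true → ∀ i → adj G (vertex′ i) u ≡ true
      candidate⇒adjacent′ u h i with candidate u in u-candidate | adj G w u in wu
      candidate⇒adjacent′ u h fz     | true | true = wu
      candidate⇒adjacent′ u h (fs i) | true | true = candidate⇒adjacent u u-candidate i
      many-candidates′ : suc x ≤ countF candidate′ + suc k * sameClassBelow x
      many-candidates′ = ≤-trans many-candidates (≤-trans
        (+-monoˡ-≤ (k * sameClassBelow x) (≤-trans (countF-≤-∧+not candidate (adj G w))
                                                   (+-monoʳ-≤ (countF candidate′) (nonNeighbours≤ w))))
        (≤-reflexive (+-assoc (countF candidate′) (sameClassBelow x) (k * sameClassBelow x))))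

    clique : ContainsClique (suc r) G
    clique = vertex , injective , adjacent
      where
      build : ∀ k → k ≤ suc r → PartialClique k
      build zero    _ = empty
      build (suc k) h = extend k (≤-pred h) (build k (≤-trans (n≤1+n k) h))
      open PartialClique (build (suc r) ≤-refl)
      injective : Injective _≡_ _≡_ vertex
      injective {i} {j} e with i ≟ᶠ j
      ... | yes i≡j = i≡j
      ... | no  i≢j with () ← trans (≡-sym (adjacent i j i≢j)) (trans (cong (λ z → adj G z (vertex j)) e) (irrefl G (vertex j)))

  turan-or-clique : ∀ {m} (G : Graph m) → edges G ≤ turanNumber r m ⊎ ContainsClique (suc r) G
  turan-or-clique {zero}  G = inj₁ z≤n
  turan-or-clique {suc x} G with minDegree-vertex G
  ... | v , _ , v-min with degree G v ≤? lastDegree x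
  ... | no  v-high = inj₂ (HighMinDegree.clique x G (λ w → <-≤-trans (≰⇒> v-high) (v-min w)))
  ... | yes v-low with turan-or-clique (induced G (punchIn v))
  ...   | inj₂ K = inj₂ (induced-clique G (punchIn v) (λ {a} {b} e → punchIn-injective v a b e) K)
  ...   | inj₁ e≤t = inj₁ (begin
    edges G                                                   ≡⟨ edges-delete G v ⟩
    edges (induced G (punchIn v)) + degree G v                ≤⟨ +-mono-≤ e≤t v-low ⟩
    turanNumber r x + lastDegree x                            ≡⟨ ≡-sym (turanNumber-suc x) ⟩
    turanNumber r (suc x)                                     ∎)
    where open ≤-Reasoning

turanNumber-lower : ∀ u x → u * (x * x) ≤ 2 * suc u * turanNumber (suc u) x + u * x
turanNumber-lower u zero    = ≤-trans (≤-reflexive (*-zeroʳ u)) z≤n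
turanNumber-lower u (suc x) = begin
  u * ((1 + x) * (1 + x))                              ≡⟨ square-suc u x ⟩
  u * (x * x) + (u * x + u * x) + u                    ≤⟨ +-monoˡ-≤ u (+-mono-≤ (turanNumber-lower u x)
                                                                               (+-mono-≤ ux≤rD ux≤rD)) ⟩
  2 * r * T x + u * x + (r * D x + r * D x) + u        ≡⟨ regroup u r (T x) (D x) x ⟩
  2 * r * (T x + D x) + u * (1 + x)                    ≡⟨ cong (λ z → 2 * r * z + u * (1 + x)) (≡-sym (turanNumber-suc x)) ⟩
  2 * r * T (suc x) + u * (1 + x)                      ∎
  where
  open ≤-Reasoning
  r = suc u
  open Turan r using (turanNumber-suc; lastDegree; sameClassBelow; lastDegree+sameClassBelow; r*sameClassBelow≤)
  T = turanNumber r
  D = lastDegree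
  square-suc : ∀ u x → u * ((1 + x) * (1 + x)) ≡ u * (x * x) + (u * x + u * x) + u
  square-suc = solve-∀
  regroup : ∀ u r t d x → 2 * r * t + u * x + (r * d + r * d) + u ≡ 2 * r * (t + d) + u * (1 + x)
  regroup = solve-∀
  ux≤rD : u * x ≤ r * D x
  ux≤rD = +-cancelʳ-≤ x (u * x) (r * D x) (begin
    u * x + x                             ≡⟨ +-comm (u * x) x ⟩
    r * x                                 ≡⟨ cong (r *_) (≡-sym (lastDegree+sameClassBelow x)) ⟩
    r * (D x + sameClassBelow x)          ≡⟨ *-distribˡ-+ r (D x) (sameClassBelow x) ⟩
    r * D x + r * sameClassBelow x        ≤⟨ +-monoʳ-≤ (r * D x) (r*sameClassBelow≤ x) ⟩
    r * D x + x                           ∎)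

-- With R = q + 1: after bounding P by R² q and one factor K from below by R³, the right side minus
-- the left is a polynomial in q − 3 and K − 1 with nonnegative coefficients (the remainder below).
deficit≤gain : ∀ q K P → 3 ≤ q → P ≤ suc q * (suc q * q) → suc q * suc q * suc q ≤ K →
  P * (suc q * (K + 1)) + 2 * ((suc q * (K + 1)) * (suc q * (K + 1))) + K * (P + 2)
    ≤ (suc q + 2) * K * (2 * (1 + K * q) + K + 1)
deficit≤gain zero                _ _ () _ _
deficit≤gain (suc zero)          _ _ (s≤s ()) _ _
deficit≤gain (suc (suc zero))    _ _ (s≤s (s≤s ())) _ _
deficit≤gain (suc (suc (suc t))) (suc k) P _ P≤ R³≤K = begin
  P * (R * (K + 1)) + 2 * ((R * (K + 1)) * (R * (K + 1))) + K * (P + 2)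
    ≤⟨ +-mono-≤ (+-monoˡ-≤ (2 * ((R * (K + 1)) * (R * (K + 1)))) (*-monoˡ-≤ (R * (K + 1)) P≤))
                (*-monoʳ-≤ K (+-monoˡ-≤ 2 P≤)) ⟩
  R * (R * q) * (R * (K + 1)) + 2 * ((R * (K + 1)) * (R * (K + 1))) + K * (R * (R * q) + 2)
    ≡⟨ expand t k ⟩
  2 * (R * R) * (K * K) + (c₁ * K + c₀)
    ≤⟨ +-monoʳ-≤ (2 * (R * R) * (K * K)) (≤-trans (m≤m+n (c₁ * K + c₀) (remainder t k)) (≤-reflexive (≡-sym (cubic t k)))) ⟩
  2 * (R * R) * (K * K) + ((1 + 3 * q) * ((R * R * R) * K) + 3 * (R + 2) * K)
    ≤⟨ +-monoʳ-≤ (2 * (R * R) * (K * K)) (+-monoˡ-≤ (3 * (R + 2) * K) (*-monoʳ-≤ (1 + 3 * q) (*-monoˡ-≤ K R³≤K))) ⟩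
  2 * (R * R) * (K * K) + ((1 + 3 * q) * (K * K) + 3 * (R + 2) * K)
    ≡⟨ collect q K ⟩
  (R + 2) * K * (2 * (1 + K * q) + K + 1) ∎
  where
  open ≤-Reasoning
  q R K c₁ c₀ : ℕ
  q = 3 + t
  R = suc q
  K = suc k
  c₁ = R * R * (R * q) + 4 * (R * R) + R * (R * q) + 2
  c₀ = R * R * (R * q) + 2 * (R * R)
  remainder : ℕ → ℕ → ℕ
  remainder t k = (352 + t * (395 + t * (165 + t * (30 + t * 2)))) * k + (128 + t * (171 + t * (79 + t * (15 + t))))
  expand : ∀ t k →
    ((4 + t) * ((4 + t) * (3 + t))) * ((4 + t) * ((1 + k) + 1)) + 2 * (((4 + t) * ((1 + k) + 1)) * ((4 + t) * ((1 + k) + 1)))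
      + (1 + k) * (((4 + t) * ((4 + t) * (3 + t))) + 2)
    ≡ 2 * ((4 + t) * (4 + t)) * ((1 + k) * (1 + k))
      + (((4 + t) * (4 + t) * ((4 + t) * (3 + t)) + 4 * ((4 + t) * (4 + t)) + (4 + t) * ((4 + t) * (3 + t)) + 2) * (1 + k)
         + ((4 + t) * (4 + t) * ((4 + t) * (3 + t)) + 2 * ((4 + t) * (4 + t))))
  expand = solve-∀
  cubic : ∀ t k →
    (1 + 3 * (3 + t)) * (((4 + t) * (4 + t) * (4 + t)) * (1 + k)) + 3 * ((4 + t) + 2) * (1 + k)
    ≡ (((4 + t) * (4 + t) * ((4 + t) * (3 + t)) + 4 * ((4 + t) * (4 + t)) + (4 + t) * ((4 + t) * (3 + t)) + 2) * (1 + k)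
       + ((4 + t) * (4 + t) * ((4 + t) * (3 + t)) + 2 * ((4 + t) * (4 + t))))
      + ((352 + t * (395 + t * (165 + t * (30 + t * 2)))) * k + (128 + t * (171 + t * (79 + t * (15 + t)))))
  cubic = solve-∀
  collect : ∀ q K → 2 * ((1 + q) * (1 + q)) * (K * K) + ((1 + 3 * q) * (K * K) + 3 * ((1 + q) + 2) * K)
    ≡ ((1 + q) + 2) * K * (2 * (1 + K * q) + K + 1)
  collect = solve-∀

-- R = r², q = r² − 1, α = (r − 1) r (r² − 1) − 1, β = (r − 1) r³ (r² − 1) + 2 and μ = 2 r⁴ (r² − 1)
-- are the constants of the statement with denominators cleared.
module Parameters (s : ℕ) where

  u r q R α p β μ : ℕ
  u = suc s
  r = suc u
  q = 3 + s * (s + 4)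
  R = suc q
  α = u * r * q ∸ 1
  p = suc α
  β = R * p + 2
  μ = 2 * (R * R) * q

  r*r≡R : r * r ≡ R
  r*r≡R = square s
    where
    square : ∀ s → (2 + s) * (2 + s) ≡ 4 + s * (s + 4)
    square = solve-∀

  p≡urq : p ≡ u * r * q
  p≡urq = m+[n∸m]≡n (s≤s z≤n)

  p≤Rq : p ≤ R * q
  p≤Rq = begin
    p          ≡⟨ p≡urq ⟩
    u * r * q  ≤⟨ *-monoˡ-≤ q (*-monoˡ-≤ r (n≤1+n u)) ⟩
    r * r * q  ≡⟨ cong (_* q) r*r≡R ⟩
    R * q      ∎
    where open ≤-Reasoning

  r^2≡R : r ^ 2 ≡ R
  r^2≡R = trans (cong (r *_) (*-identityʳ r)) r*r≡R

  r^2∸1≡q : r ^ 2 ∸ 1 ≡ q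
  r^2∸1≡q = cong (_∸ 1) r^2≡R

  α-form : (r ∸ 1) * r * (r ^ 2 ∸ 1) ∸ 1 ≡ α
  α-form = cong (λ z → u * r * z ∸ 1) r^2∸1≡q

  β-form : (r ∸ 1) * r ^ 3 * (r ^ 2 ∸ 1) + 2 ≡ β
  β-form = cong (_+ 2) (begin
    u * r ^ 3 * (r ^ 2 ∸ 1)  ≡⟨ cong (u * r ^ 3 *_) r^2∸1≡q ⟩
    u * r ^ 3 * q            ≡⟨ regroup u r q ⟩
    (r * r) * (u * r * q)    ≡⟨ cong₂ _*_ r*r≡R (≡-sym p≡urq) ⟩
    R * p                    ∎)
    where
    open ≡-Reasoning
    regroup : ∀ u r q → u * (r * (r * (r * 1))) * q ≡ (r * r) * (u * r * q)
    regroup = solve-∀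

  μ-form : 2 * r ^ 4 * (r ^ 2 ∸ 1) ≡ μ
  μ-form = cong₂ (λ x y → 2 * x * y) (trans (fourth r) (cong₂ _*_ r*r≡R r*r≡R)) r^2∸1≡q
    where
    fourth : ∀ x → x * (x * (x * (x * 1))) ≡ (x * x) * (x * x)
    fourth = solve-∀

  r^8≡R⁴ : r ^ 8 ≡ R * R * R * R
  r^8≡R⁴ = trans (eighth r) (cong (λ z → z * z * z * z) r*r≡R)
    where
    eighth : ∀ x → x * (x * (x * (x * (x * (x * (x * (x * 1))))))) ≡ (x * x) * (x * x) * (x * x) * (x * x)
    eighth = solve-∀

  module Process (n₀ : ℕ) (r⁸<n : r ^ 8 < suc n₀) (G : Graph (suc n₀))
                 (t<e : turanNumber r (suc n₀) < edges G) where

    open Turan r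

    n K b : ℕ
    n = suc n₀
    K = n₀ / R
    b = n₀ % R

    n₀≡b+KR : n₀ ≡ b + K * R
    n₀≡b+KR = m≡m%n+[m/n]*n n₀ R

    b≤q : b ≤ q
    b≤q = ≤-pred (m%n<n n₀ R)

    RK<n : R * K < n
    RK<n = s≤s (begin
      R * K      ≡⟨ *-comm R K ⟩
      K * R      ≤⟨ m≤n+m (K * R) b ⟩
      b + K * R  ≡⟨ ≡-sym n₀≡b+KR ⟩
      n₀         ∎)
      where open ≤-Reasoning

    n≤R[K+1] : n ≤ R * (K + 1)
    n≤R[K+1] = begin
      suc n₀             ≡⟨ cong suc n₀≡b+KR ⟩
      suc (b + K * R)    ≤⟨ s≤s (+-monoˡ-≤ (K * R) b≤q) ⟩
      suc (q + K * R)    ≡⟨ regroup q K ⟩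
      R * (K + 1)        ∎
      where
      open ≤-Reasoning
      regroup : ∀ q K → suc (q + K * suc q) ≡ suc q * (K + 1)
      regroup = solve-∀

    R⁴<n : R * R * R * R < n
    R⁴<n = subst (_< n) r^8≡R⁴ r⁸<n

    R³≤K : R * R * R ≤ K
    R³≤K = ≤-pred (*-cancelˡ-< R (R * R * R) (1 + K) (begin-strict
      R * (R * R * R)  ≡⟨ regroup R ⟩
      R * R * R * R    <⟨ R⁴<n ⟩
      n                ≤⟨ n≤R[K+1] ⟩
      R * (K + 1)      ≡⟨ cong (R *_) (+-comm K 1) ⟩
      R * (1 + K)      ∎))
      where
      open ≤-Reasoning
      regroup : ∀ R → R * (R * R * R) ≡ R * R * R * R
      regroup = solve-∀

    order-large : ∀ i m → m + i ≡ n → i ≤ K → q * n < R * m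
    order-large i m m+i≡n i≤K = +-cancelʳ-< n (q * n) (R * m) (begin-strict
      q * n + n              ≡⟨ cong (λ z → q * z + z) (≡-sym m+i≡n) ⟩
      q * (m + i) + (m + i)  ≡⟨ distrib q m i ⟩
      R * m + R * i          <⟨ +-monoʳ-< (R * m) (≤-<-trans (*-monoʳ-≤ R i≤K) RK<n) ⟩
      R * m + n              ∎)
      where
      open ≤-Reasoning
      distrib : ∀ q m i → q * (m + i) + (m + i) ≡ suc q * m + suc q * i
      distrib = solve-∀

    p≤order : ∀ m → q * n < R * m → p ≤ m
    p≤order m qn<Rm = <⇒≤ (*-cancelˡ-< R p m (begin-strict
      R * p                  ≤⟨ *-monoʳ-≤ R (≤-trans p≤Rq (*-monoʳ-≤ R (n≤1+n q))) ⟩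
      R * (R * R)            ≤⟨ m≤m*n (R * (R * R)) (q * R) ⟩
      R * (R * R) * (q * R)  ≡⟨ regroup q R ⟩
      q * (R * R * R * R)    ≤⟨ *-monoʳ-≤ q (<⇒≤ R⁴<n) ⟩
      q * n                  <⟨ qn<Rm ⟩
      R * m                  ∎))
      where
      open ≤-Reasoning
      regroup : ∀ q R → R * (R * R) * (q * R) ≡ q * (R * R * R * R)
      regroup = solve-∀

    lowDegree≤lastDegree : ∀ m d → R * q * d ≤ α * suc m → p ≤ suc m → d ≤ lastDegree m
    lowDegree≤lastDegree m d Rqd≤αm p≤m = +-cancelʳ-≤ (sameClassBelow m) d (lastDegree m) (*-cancelˡ-≤ r (begin
      r * (d + sameClassBelow m)           ≡⟨ *-distribˡ-+ r d (sameClassBelow m) ⟩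
      r * d + r * sameClassBelow m         ≤⟨ +-mono-≤ rd≤um (r*sameClassBelow≤ m) ⟩
      u * m + m                            ≡⟨ +-comm (u * m) m ⟩
      r * m                                ≡⟨ cong (r *_) (≡-sym (lastDegree+sameClassBelow m)) ⟩
      r * (lastDegree m + sameClassBelow m) ∎))
      where
      open ≤-Reasoning
      αm≤pm : α * suc m ≤ p * m
      αm≤pm = +-cancelʳ-≤ (suc m) (α * suc m) (p * m) (begin
        α * suc m + suc m  ≡⟨ distrib α m ⟩
        p * m + p          ≤⟨ +-monoʳ-≤ (p * m) p≤m ⟩
        p * m + suc m      ∎)
        where
        distrib : ∀ a m → a * suc m + suc m ≡ suc a * m + suc a
        distrib = solve-∀
      rd≤um : r * d ≤ u * m
      rd≤um = *-cancelˡ-≤ (r * q) (begin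
        r * q * (r * d)   ≡⟨ regroup₁ r q d ⟩
        r * r * q * d     ≡⟨ cong (λ z → z * q * d) r*r≡R ⟩
        R * q * d         ≤⟨ Rqd≤αm ⟩
        α * suc m         ≤⟨ αm≤pm ⟩
        p * m             ≡⟨ cong (_* m) p≡urq ⟩
        u * r * q * m     ≡⟨ regroup₂ u r q m ⟩
        r * q * (u * m)   ∎)
        where
        regroup₁ : ∀ r q d → r * q * (r * d) ≡ r * r * q * d
        regroup₁ = solve-∀
        regroup₂ : ∀ u r q m → u * r * q * m ≡ r * q * (u * m)
        regroup₂ = solve-∀

    X Y : ℕ
    X = R * p * n + 2 * (n * n)
    Y = (R + 2) * (n * n + n)

    -- After i deletions, with m vertices and e edges left, the quantity
    -- μ e − β m² + (R + 2)(m² + m) + i β is still at least its initial value μ + Y − X.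
    Potential : ℕ → ℕ → ℕ → Set
    Potential i m e = β * (m * m) + Y + μ ≤ μ * e + X + i * β + (R + 2) * (m * m + m)

    potential-start : Potential 0 n (edges G)
    potential-start = begin
      β * (n * n) + Y + μ
        ≡⟨ split-β (R * p) μ Y (n * n) ⟩
      R * p * (n * n) + (2 * (n * n) + μ + Y)
        ≡⟨ cong (_+ (2 * (n * n) + μ + Y)) quadratic ⟩
      R * r * q * (u * (n * n)) + (2 * (n * n) + μ + Y)
        ≤⟨ +-monoˡ-≤ (2 * (n * n) + μ + Y) (*-monoʳ-≤ (R * r * q) (turanNumber-lower u n)) ⟩
      R * r * q * (2 * r * turanNumber r n + u * n) + (2 * (n * n) + μ + Y)
        ≡⟨ cong (_+ (2 * (n * n) + μ + Y)) linear ⟩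
      μ * turanNumber r n + R * p * n + (2 * (n * n) + μ + Y)
        ≡⟨ regroup μ (turanNumber r n) (R * p) n β Y ⟩
      μ * suc (turanNumber r n) + X + 0 * β + Y
        ≤⟨ +-monoˡ-≤ Y (+-monoˡ-≤ (0 * β) (+-monoˡ-≤ X (*-monoʳ-≤ μ t<e))) ⟩
      μ * edges G + X + 0 * β + Y ∎
      where
      open ≤-Reasoning
      split-β : ∀ P M Y x → (P + 2) * x + Y + M ≡ P * x + (2 * x + M + Y)
      split-β = solve-∀
      regroup : ∀ M t A n B Y → M * t + A * n + (2 * (n * n) + M + Y) ≡ M * suc t + (A * n + 2 * (n * n)) + 0 * B + Y
      regroup = solve-∀
      quadratic : R * p * (n * n) ≡ R * r * q * (u * (n * n))
      quadratic = trans (cong (λ z → R * z * (n * n)) p≡urq) (reassoc R u r q (n * n))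
        where
        reassoc : ∀ R u r q x → R * (u * r * q) * x ≡ R * r * q * (u * x)
        reassoc = solve-∀
      linear : R * r * q * (2 * r * turanNumber r n + u * n) ≡ μ * turanNumber r n + R * p * n
      linear = trans (expand R r u q (turanNumber r n) n)
                     (cong₂ (λ z w → 2 * (R * z) * q * turanNumber r n + R * w * n) r*r≡R (≡-sym p≡urq))
        where
        expand : ∀ R r u q t n → R * r * q * (2 * r * t + u * n) ≡ 2 * (R * (r * r)) * q * t + R * (u * r * q) * n
        expand = solve-∀

    -- Deleting a vertex of degree d ≤ α (m + 1) / (R q) costs μ d ≤ 2 R α (m + 1) in μ e but saves
    -- β (2 m + 1) in β m²; the surplus 2 (R + 2)(m + 1) − β is what the other two terms absorb.
    potential-delete : ∀ i m e d → Potential i (suc m) (e + d) → R * q * d ≤ α * suc m → Potential (suc i) m e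
    potential-delete i m e d P Rqd≤αm = +-cancelʳ-≤ (2 * β * suc m) _ _ (begin
      β * (m * m) + Y + μ + 2 * β * suc m
        ≡⟨ square-suc β μ Y m ⟩
      β * (suc m * suc m) + Y + μ + β
        ≤⟨ +-monoˡ-≤ β P ⟩
      μ * (e + d) + X + i * β + (R + 2) * (suc m * suc m + suc m) + β
        ≡⟨ regroup β μ R X i m e d ⟩
      μ * d + (W + (R + 2) * (2 * suc m))
        ≤⟨ +-monoˡ-≤ (W + (R + 2) * (2 * suc m)) μd≤ ⟩
      2 * R * (α * suc m) + (W + (R + 2) * (2 * suc m))
        ≡⟨ collect R α W m ⟩
      W + 2 * β * suc m ∎)
      where
      open ≤-Reasoning
      W = μ * e + X + suc i * β + (R + 2) * (m * m + m)
      μd≤ : μ * d ≤ 2 * R * (α * suc m)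
      μd≤ = ≤-trans (≤-reflexive (reassoc R q d)) (*-monoʳ-≤ (2 * R) Rqd≤αm)
        where
        reassoc : ∀ R q d → 2 * (R * R) * q * d ≡ 2 * R * (R * q * d)
        reassoc = solve-∀
      square-suc : ∀ B M Y m → B * (m * m) + Y + M + 2 * B * suc m ≡ B * (suc m * suc m) + Y + M + B
      square-suc = solve-∀
      regroup : ∀ B M R X i m e d →
        M * (e + d) + X + i * B + (R + 2) * (suc m * suc m + suc m) + B
          ≡ M * d + ((M * e + X + suc i * B + (R + 2) * (m * m + m)) + (R + 2) * (2 * suc m))
      regroup = solve-∀
      collect : ∀ R a W m → 2 * R * (a * suc m) + (W + (R + 2) * (2 * suc m)) ≡ W + 2 * (R * suc a + 2) * suc m
      collect = solve-∀

    potential-final : ∀ m e → m + K ≡ n → Potential K m e → β * (m * m) < μ * e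
    potential-final m e m+K≡n P = begin-strict
      β * (m * m)       <⟨ m<m+n (β * (m * m)) (s≤s z≤n) ⟩
      β * (m * m) + μ   ≤⟨ +-cancelʳ-≤ Y (β * (m * m) + μ) (μ * e) bound ⟩
      μ * e             ∎
      where
      open ≤-Reasoning
      m≥ : suc (K * q) ≤ m
      m≥ = +-cancelʳ-≤ K (suc (K * q)) m (begin
        suc (K * q) + K   ≡⟨ regroup K q ⟩
        suc (R * K)       ≤⟨ RK<n ⟩
        n                 ≡⟨ ≡-sym m+K≡n ⟩
        m + K             ∎)
        where
        regroup : ∀ K q → suc (K * q) + K ≡ suc (suc q * K)
        regroup = solve-∀
      gain : X + K * β + (R + 2) * (m * m + m) ≤ Y
      gain = begin
        X + K * β + (R + 2) * (m * m + m)
          ≤⟨ +-monoˡ-≤ ((R + 2) * (m * m + m)) (+-monoˡ-≤ (K * β)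
               (+-mono-≤ (*-monoʳ-≤ (R * p) n≤R[K+1]) (*-monoʳ-≤ 2 (*-mono-≤ n≤R[K+1] n≤R[K+1])))) ⟩
        R * p * (R * (K + 1)) + 2 * ((R * (K + 1)) * (R * (K + 1))) + K * β + (R + 2) * (m * m + m)
          ≤⟨ +-monoˡ-≤ ((R + 2) * (m * m + m)) (deficit≤gain q K (R * p) (s≤s (s≤s (s≤s z≤n))) (*-monoʳ-≤ R p≤Rq) R³≤K) ⟩
        (R + 2) * K * (2 * (1 + K * q) + K + 1) + (R + 2) * (m * m + m)
          ≤⟨ +-monoˡ-≤ ((R + 2) * (m * m + m)) (*-monoʳ-≤ ((R + 2) * K) (+-monoˡ-≤ 1 (+-monoˡ-≤ K (*-monoʳ-≤ 2 m≥)))) ⟩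
        (R + 2) * K * (2 * m + K + 1) + (R + 2) * (m * m + m)
          ≡⟨ telescope R m K ⟩
        (R + 2) * ((m + K) * (m + K) + (m + K))
          ≡⟨ cong (λ z → (R + 2) * (z * z + z)) m+K≡n ⟩
        Y ∎
        where
        telescope : ∀ R m K → (R + 2) * K * (2 * m + K + 1) + (R + 2) * (m * m + m) ≡ (R + 2) * ((m + K) * (m + K) + (m + K))
        telescope = solve-∀
      bound : β * (m * m) + μ + Y ≤ μ * e + Y
      bound = begin
        β * (m * m) + μ + Y                               ≡⟨ +-right-comm (β * (m * m)) μ Y ⟩
        β * (m * m) + Y + μ                               ≤⟨ P ⟩
        μ * e + X + K * β + (R + 2) * (m * m + m)         ≡⟨ reassoc (μ * e) X (K * β) ((R + 2) * (m * m + m)) ⟩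
        μ * e + (X + K * β + (R + 2) * (m * m + m))       ≤⟨ +-monoʳ-≤ (μ * e) gain ⟩
        μ * e + Y                                         ∎
        where
        +-right-comm : ∀ x y z → x + y + z ≡ x + z + y
        +-right-comm = solve-∀
        reassoc : ∀ w x y z → w + x + y + z ≡ w + (x + y + z)
        reassoc = solve-∀

    record Stage (i : ℕ) : Set where
      constructor stage
      field
        order           : ℕ
        embed           : Fin order → Fin n
        embed-injective : Injective _≡_ _≡_ embed
        order+i≡n       : order + i ≡ n
        above-turan     : turanNumber r order < edges (induced G embed)
        potential       : Potential i order (edges (induced G embed))

    MinDegreeHigh : ∀ {i} → Stage i → Set
    MinDegreeHigh (stage m f _ _ _ _) = α * m < R * q * minDegree (induced G f)

    Outcome : Set
    Outcome = Σ ℕ λ n' → Σ (Fin n' → Fin n) λ f → Injective _≡_ _≡_ f ×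
      ((r ^ 2 ∸ 1) * n < r ^ 2 * n') ×
      ((ContainsClique (r + 1) (induced G f) ×
          (((r ∸ 1) * r * (r ^ 2 ∸ 1) ∸ 1) * n' < r ^ 2 * (r ^ 2 ∸ 1) * minDegree (induced G f)))
       ⊎ (((r ∸ 1) * r ^ 3 * (r ^ 2 ∸ 1) + 2) * (n' * n') < 2 * r ^ 4 * (r ^ 2 ∸ 1) * edges (induced G f)))

    order-condition : ∀ i m → m + i ≡ n → i ≤ K → (r ^ 2 ∸ 1) * n < r ^ 2 * m
    order-condition i m m+i≡n i≤K =
      subst₂ (λ x y → x * n < y * m) (≡-sym r^2∸1≡q) (≡-sym r^2≡R) (order-large i m m+i≡n i≤K)

    finish-dense : Stage K → Outcome
    finish-dense (stage m f f-inj m+K≡n _ P) = m , f , f-inj , order-condition K m m+K≡n ≤-refl ,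
      inj₂ (subst₂ (λ x y → x * (m * m) < y * edges (induced G f)) (≡-sym β-form) (≡-sym μ-form)
                   (potential-final m (edges (induced G f)) m+K≡n P))

    finish-clique : ∀ i → i ≤ K → (st : Stage i) → MinDegreeHigh st → Outcome
    finish-clique i i≤K (stage m f f-inj m+i≡n t<e′ _) high = m , f , f-inj , order-condition i m m+i≡n i≤K ,
      inj₁ (clique , subst₂ (λ x y → x * m < y * minDegree (induced G f)) (≡-sym α-form) (cong₂ _*_ (≡-sym r^2≡R) (≡-sym r^2∸1≡q)) high)
      where
      clique : ContainsClique (r + 1) (induced G f)
      clique with turan-or-clique (induced G f)
      ... | inj₁ e≤t = ⊥-elim (<⇒≱ t<e′ e≤t)
      ... | inj₂ c   = subst (λ k → ContainsClique k (induced G f)) (+-comm 1 r) c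

    delete-min-degree : ∀ i → i ≤ K → (st : Stage i) → ¬ MinDegreeHigh st → Stage (suc i)
    delete-min-degree i i≤K (stage zero f _ 0+i≡n _ _) _ =
      ⊥-elim (n≮0 (subst (q * n <_) (*-zeroʳ R) (order-large i zero 0+i≡n i≤K)))
    delete-min-degree i i≤K (stage (suc m) f f-inj m+i≡n t<e′ P) low =
      stage m f′ f′-inj (trans (+-suc m i) m+i≡n) above-turan′ potential′
      where
      H = induced G f
      v = proj₁ (minDegree-vertex H)
      d = degree H v
      f′ : Fin m → Fin n
      f′ j = f (punchIn v j)
      f′-inj : Injective _≡_ _≡_ f′
      f′-inj {x} {y} e = punchIn-injective v x y (f-inj e)
      e≡e′+d : edges H ≡ edges (induced G f′) + d
      e≡e′+d = edges-delete H v
      Rqd≤αm : R * q * d ≤ α * suc m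
      Rqd≤αm = ≤-trans (*-monoʳ-≤ (R * q) (proj₁ (proj₂ (minDegree-vertex H)))) (≮⇒≥ low)
      d≤D : d ≤ lastDegree m
      d≤D = lowDegree≤lastDegree m d Rqd≤αm (p≤order (suc m) (order-large i (suc m) m+i≡n i≤K))
      above-turan′ : turanNumber r m < edges (induced G f′)
      above-turan′ = +-cancelʳ-< (lastDegree m) (turanNumber r m) (edges (induced G f′))
        (<-≤-trans (subst₂ _<_ (turanNumber-suc m) e≡e′+d t<e′) (+-monoʳ-≤ (edges (induced G f′)) d≤D))
      potential′ : Potential (suc i) m (edges (induced G f′))
      potential′ = potential-delete i m (edges (induced G f′)) d (subst (Potential i (suc m)) e≡e′+d P) Rqd≤αm

    run : ∀ k i → i + k ≡ K → Stage i → Outcome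
    run zero    i i+0≡K st = finish-dense (subst Stage (trans (≡-sym (+-identityʳ i)) i+0≡K) st)
    run (suc k) i i+k≡K st with α * Stage.order st <? R * q * minDegree (induced G (Stage.embed st))
    ... | yes high = finish-clique i (≤-trans (m≤m+n i (suc k)) (≤-reflexive i+k≡K)) st high
    ... | no  low  = run k (suc i) (trans (≡-sym (+-suc i k)) i+k≡K)
                         (delete-min-degree i (≤-trans (m≤m+n i (suc k)) (≤-reflexive i+k≡K)) st low)

    outcome : Outcome
    outcome = run K 0 refl (stage n (λ j → j) (λ e → e) (+-identityʳ n) t<e potential-start)

theorem6 : (r : ℕ) .{{_ : NonZero r}} → 2 ≤ r → (n : ℕ) → r ^ 8 < n →
    (G : Graph n) → turanNumber r n < edges G →
    Σ ℕ λ n' → Σ (Fin n' → Fin n) λ f → Injective _≡_ _≡_ f ×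
      ((r ^ 2 ∸ 1) * n < r ^ 2 * n') ×
      ((ContainsClique (r + 1) (induced G f) ×
          (((r ∸ 1) * r * (r ^ 2 ∸ 1) ∸ 1) * n'
             < r ^ 2 * (r ^ 2 ∸ 1) * minDegree (induced G f)))
       ⊎ (((r ∸ 1) * r ^ 3 * (r ^ 2 ∸ 1) + 2) * (n' * n')
             < 2 * r ^ 4 * (r ^ 2 ∸ 1) * edges (induced G f)))
theorem6 zero ()
theorem6 (suc zero) (s≤s ())
theorem6 (suc (suc s)) _ zero () G t<e
theorem6 (suc (suc s)) _ (suc n₀) r⁸<n G t<e = Parameters.Process.outcome s n₀ r⁸<n G t<e
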